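{- For every connected graph $G$ of order $n\geq 3$ and every integer $k$ with $3\leq k\leq n$, $$px_k(G)\leq \min\{\Delta(T): T \text{ is a spanning tree of } G\},$$ where $\Delta(T)$ denotes the maximum degree of $T$.
   Context: All graphs are finite, simple, undirected and connected. An edge-coloring of a graph $G$ assigns colors to edges (adjacent edges may receive the same color). A tree in an edge-colored graph is a proper tree if any two adjacent edges of it receive different colors. For $S\subseteq V(G)$, an $S$-tree is a tree in $G$ containing all vertices of $S$. For a graph $G$ of order $n$ and an integer $k$ with $2\leq k\leq n$, an edge-coloring of $G$ is a $k$-proper coloring if for every set $S$ of $k$ vertices of $G$ there is a proper $S$-tree in $G$. The $k$-proper index $px_k(G)$ of a nontrivial connected graph $G$ is the smallest number of colors in a $k$-proper coloring of $G$. -}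

module Defs where

open import Data.Nat using (ℕ; zero; suc; _≤_; _⊔_)
open import Data.Fin using (Fin)
open import Data.Fin.Subset using (Subset; _∈_; _⊆_; ∣_∣; ⊤)
open import Data.Bool using (Bool; true; false; if_then_else_)
open import Data.List using (List; []; _∷_; length; map; foldr; allFin)
open import Data.Nat.ListAction using (sum)
open import Data.List.Relation.Unary.Unique.Propositional using (Unique)
open import Data.Product using (Σ; _×_; ∃)
open import Data.Empty using (⊥)
open import Relation.Binary.PropositionalEquality using (_≡_; _≢_)

record Graph (n : ℕ) : Set where
  field
    adj     : Fin n → Fin n → Bool
    sym     : ∀ u v → adj u v ≡ adj v u
    irrefl  : ∀ v → adj v v ≡ false
open Graph public

data Walk {n : ℕ} (E : Fin n → Fin n → Bool) : Fin n → Fin n → Set where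
  here : ∀ {v} → Walk E v v
  step : ∀ {u w v} → E u w ≡ true → Walk E w v → Walk E u v

Connected : ∀ {n} → Graph n → Set
Connected {n} G = ∀ (u v : Fin n) → Walk (adj G) u v

Chain : ∀ {n} → (Fin n → Fin n → Bool) → Fin n → List (Fin n) → Fin n → Set
Chain E x []       y = E x y ≡ true
Chain E x (z ∷ zs) y = (E x z ≡ true) × Chain E z zs y

ClosedChain : ∀ {n} → (Fin n → Fin n → Bool) → List (Fin n) → Set
ClosedChain E []       = ⊥
ClosedChain E (x ∷ xs) = Chain E x xs x

record Cycle {n : ℕ} (E : Fin n → Fin n → Bool) : Set where
  field
    verts  : List (Fin n)
    long   : 3 ≤ length verts
    uniq   : Unique verts
    closed : ClosedChain E verts

record Tree {n : ℕ} (G : Graph n) : Set where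
  field
    V        : Subset n
    E        : Fin n → Fin n → Bool
    E-sym    : ∀ u v → E u v ≡ E v u
    E⊆G      : ∀ u v → E u v ≡ true → adj G u v ≡ true
    E⊆V      : ∀ u v → E u v ≡ true → u ∈ V
    nonempty : ∃ λ v → v ∈ V
    conn     : ∀ u v → u ∈ V → v ∈ V → Walk E u v
    acyclic  : Cycle E → ⊥
open Tree public

SpanningTree : ∀ {n} (G : Graph n) → Tree G → Set
SpanningTree G T = ∀ v → v ∈ V T

record EdgeColoring {n : ℕ} (G : Graph n) (d : ℕ) : Set where
  field
    col     : Fin n → Fin n → Fin d
    col-sym : ∀ u v → col u v ≡ col v u
open EdgeColoring public

ProperTree : ∀ {n d} {G : Graph n} → EdgeColoring G d → Tree G → Set
ProperTree {n} c T = ∀ (u v w : Fin n) → E T u v ≡ true → E T v w ≡ true →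
                     u ≢ w → col c u v ≢ col c v w

KProper : ∀ {n d} (G : Graph n) → ℕ → EdgeColoring G d → Set
KProper {n} G k c = ∀ (S : Subset n) → ∣ S ∣ ≡ k →
                    Σ (Tree G) λ T → (S ⊆ V T) × ProperTree c T

-- px_k(G) ≤ d : there is a k-proper coloring using (at most) d colors.
px≤ : ∀ {n} (G : Graph n) (k d : ℕ) → Set
px≤ G k d = Σ (EdgeColoring G d) λ c → KProper G k c

degree : ∀ {n} {G : Graph n} → Tree G → Fin n → ℕ
degree {n} T v = sum (map (λ w → if E T v w then 1 else 0) (allFin n))

maxDegree : ∀ {n} {G : Graph n} → Tree G → ℕ
maxDegree {n} T = foldr _⊔_ 0 (map (degree T) (allFin n))

-- Root the spanning tree T at a vertex r: breadth-first search gives every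
-- other vertex a parent, a T-neighbour closer to r, and the parent edges form a
-- spanning tree inside T.
-- Colour the edge from a vertex c to its parent v by the position of c among
-- the children of v, skipping the colour of the edge from v to its own parent
-- (punchIn). A non-root vertex v has at most deg v - 1 children, so Δ(T)
-- colours suffice, and adjacent edges get distinct colours: either they share
-- the parent (distinct positions) or one is the parent edge of the other
-- (skipped colour). A properly coloured spanning tree is a proper S-tree for
-- every S, whatever k is.
module Submission where

open import Defs hiding (sym)
open import Data.Bool using (Bool; true; false; if_then_else_)
open import Data.Empty using (⊥; ⊥-elim)
open import Data.Fin using (Fin; zero; suc; toℕ; fromℕ<; punchIn) renaming (_<_ to _<ᶠ_)
open import Data.Fin.Properties
  using (_≟_; _<?_; <-cmp; <-trans; any?; toℕ-fromℕ<; punchIn-injective; punchInᵢ≢i)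
open import Data.Fin.Subset using (⊤)
open import Data.Fin.Subset.Properties using (∈⊤)
open import Data.List using (List; []; _∷_; _++_; [_]; map; foldr; length; allFin)
open import Data.List.Properties using (++-identityʳ; ++-assoc)
open import Data.List.Extrema.Nat using (argmax; argmax-sel; f[⊥]≤f[argmax]; f[xs]≤f[argmax])
open import Data.List.Membership.Propositional using (_∈_)
open import Data.List.Membership.Propositional.Properties using (∈-allFin; ∈-∃++)
import Data.List.Relation.Binary.Permutation.Setoid as Permutation
import Data.List.Relation.Binary.Permutation.Setoid.Properties as PermutationProperties
import Data.List.Relation.Unary.All as All
open import Data.List.Relation.Unary.AllPairs using (_∷_)
open import Data.List.Relation.Unary.Any using (here; there)
open import Data.List.Relation.Unary.Unique.Propositional using (Unique)
open import Data.Nat using (ℕ; zero; suc; _≤_; _<_; _⊔_; z≤n; s≤s; s≤s⁻¹)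
open import Data.Nat.ListAction using (sum)
open import Data.Nat.Properties
  using (≤-refl; ≤-trans; <-≤-trans; <-irrefl; <-asym; m≤m⊔n; m≤n⇒m≤o⊔n; +-mono-≤; +-mono-≤-<)
import Data.Bool.Properties as Bool
open import Data.Product using (∃; ∃₂; _×_; _,_; proj₁; proj₂)
open import Data.Sum using (_⊎_; inj₁; inj₂)
import Data.Sum as Sum
open import Function using (_∘_; mk⇔)
open import Relation.Binary.Definitions using (tri<; tri≈; tri>)
open import Relation.Binary.PropositionalEquality
  using (_≡_; _≢_; refl; sym; trans; cong; subst; ≢-sym; setoid; module ≡-Reasoning)
open import Relation.Nullary using (Dec; yes; no; ¬_; does; ¬?; _×-dec_; _⊎-dec_)
open import Relation.Nullary.Decidable using (dec-true; dec-false; does-⇔)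
open import Relation.Unary using (Pred; Decidable)

witness : ∀ {a} {A : Set a} (a? : Dec A) → does a? ≡ true → A
witness (yes a) _ = a

least : ∀ {p} {P : Pred ℕ p} → Decidable P → ℕ → ℕ
least P? zero    = zero
least P? (suc b) with P? zero
... | yes _ = zero
... | no  _ = suc (least (P? ∘ suc) b)

least-holds : ∀ {p} {P : Pred ℕ p} (P? : Decidable P) b → P b → P (least P? b)
least-holds P? zero    Pb = Pb
least-holds P? (suc b) Pb with P? zero
... | yes P0 = P0
... | no  _  = least-holds (P? ∘ suc) b Pb

least-≤ : ∀ {p} {P : Pred ℕ p} (P? : Decidable P) b {i} → P i → least P? b ≤ i
least-≤ P? zero    _ = z≤n
least-≤ P? (suc b) {i} Pi with P? zero
least-≤ P? (suc b) {i}     Pi | yes _  = z≤n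
least-≤ P? (suc b) {zero}  Pi | no ¬P0 = ⊥-elim (¬P0 Pi)
least-≤ P? (suc b) {suc i} Pi | no _   = s≤s (least-≤ (P? ∘ suc) b Pi)

count : ∀ {a} {A : Set a} → (A → Bool) → List A → ℕ
count p xs = sum (map (λ x → if p x then 1 else 0) xs)

module _ {a} {A : Set a} {p q : A → Bool} (p⇒q : ∀ {x} → p x ≡ true → q x ≡ true) where

  private
    indicator-mono : ∀ x → (if p x then 1 else 0) ≤ (if q x then 1 else 0)
    indicator-mono x with p x in px | q x in qx
    ... | false | _     = z≤n
    ... | true  | true  = ≤-refl
    ... | true  | false with () ← trans (sym (p⇒q px)) qx

  count-mono : ∀ xs → count p xs ≤ count q xs
  count-mono []       = z≤n
  count-mono (x ∷ xs) = +-mono-≤ (indicator-mono x) (count-mono xs)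

  count-mono-< : ∀ {x xs} → x ∈ xs → p x ≡ false → q x ≡ true → count p xs < count q xs
  count-mono-< {xs = _ ∷ xs} (here refl) px qx rewrite px | qx = s≤s (count-mono xs)
  count-mono-< {xs = y ∷ _}  (there x∈)  px qx = +-mono-≤-< (indicator-mono y) (count-mono-< x∈ px qx)

≤-foldr-⊔ : ∀ {a} {A : Set a} (f : A → ℕ) {x} xs → x ∈ xs → f x ≤ foldr _⊔_ 0 (map f xs)
≤-foldr-⊔ f (y ∷ ys) (here refl) = m≤m⊔n (f y) _
≤-foldr-⊔ f (y ∷ ys) (there x∈)  = m≤n⇒m≤o⊔n (f y) (≤-foldr-⊔ f ys x∈)

argmax-∈ : ∀ {a} {A : Set a} (f : A → ℕ) x xs → argmax f x xs ∈ x ∷ xs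
argmax-∈ f x xs with argmax-sel f x xs
... | inj₁ m≡x = here m≡x
... | inj₂ m∈xs = there m∈xs

argmax-maximal : ∀ {a} {A : Set a} (f : A → ℕ) x xs → ∀ {y} → y ∈ x ∷ xs → f y ≤ f (argmax f x xs)
argmax-maximal f x xs (here refl) = f[⊥]≤f[argmax] {f = f} x xs
argmax-maximal f x xs (there y∈)  = All.lookup (f[xs]≤f[argmax] {f = f} x xs) y∈

module _ {n : ℕ} {E : Fin n → Fin n → Bool} where

  _◅◅_ : ∀ {u v w} → Walk E u v → Walk E v w → Walk E u w
  here     ◅◅ q = q
  step e p ◅◅ q = step e (p ◅◅ q)

  walk-reverse : (∀ u v → E u v ≡ E v u) → ∀ {u v} → Walk E u v → Walk E v u
  walk-reverse E-sym here = here
  walk-reverse E-sym {u} (step {w = w} e p) =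
    walk-reverse E-sym p ◅◅ step (trans (E-sym w u) e) here

  walk-length : ∀ {u v} → Walk E u v → ℕ
  walk-length here       = 0
  walk-length (step _ p) = suc (walk-length p)

module _ {n : ℕ} (E : Fin n → Fin n → Bool) where

  chain-snoc : ∀ {x y z} zs → Chain E x zs y → E y z ≡ true → Chain E x (zs ++ [ y ]) z
  chain-snoc []       xy         yz = xy , yz
  chain-snoc (_ ∷ zs) (xz , zsy) yz = xz , chain-snoc zs zsy yz

  closedChain-rotate : ∀ as b bs → ClosedChain E (as ++ b ∷ bs) → ClosedChain E (b ∷ bs ++ as)
  closedChain-rotate []       b bs c = subst (λ l → Chain E b l b) (sym (++-identityʳ bs)) c
  closedChain-rotate (a ∷ as) b bs c =
    subst (λ l → Chain E b l b) (++-assoc bs [ a ] as)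
      (closedChain-rotate as b (bs ++ [ a ])
        (subst (ClosedChain E) (++-assoc as (b ∷ bs) [ a ]) (rotate-head (as ++ b ∷ bs) c)))
    where
      rotate-head : ∀ ys → Chain E a ys a → ClosedChain E (ys ++ [ a ])
      rotate-head []       aa         = aa
      rotate-head (_ ∷ zs) (ay , zsa) = chain-snoc zs zsa ay

  chain-last : ∀ {x y zs z} → Chain E x (y ∷ zs) z → ∃ λ l → l ∈ y ∷ zs × E l z ≡ true
  chain-last {y = y} {zs = []}    (_ , yz) = y , here refl , yz
  chain-last         {zs = _ ∷ _} (_ , c)  with l , l∈ , lz ← chain-last c = l , there l∈ , lz

  closedChain-neighbours : ∀ {m} ys → 3 ≤ length (m ∷ ys) → Unique (m ∷ ys) → Chain E m ys m →
                           ∃₂ λ a b → a ≢ b × a ∈ ys × b ∈ ys × E a m ≡ true × E m b ≡ true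
  closedChain-neighbours []          (s≤s ()) _ _
  closedChain-neighbours (_ ∷ [])    (s≤s (s≤s ())) _ _
  closedChain-neighbours (y ∷ _ ∷ _) _ (_ ∷ y∉ ∷ _) (my , c) with l , l∈ , lm ← chain-last c =
    l , y , ≢-sym (All.lookup y∉ l∈) , there l∈ , here refl , lm , my

  cycle-neighbours : (C : Cycle E) → ∀ {m} → m ∈ Cycle.verts C →
                     ∃₂ λ a b → a ≢ b × a ∈ Cycle.verts C × b ∈ Cycle.verts C ×
                                E a m ≡ true × E m b ≡ true
  cycle-neighbours C {m} m∈ with as , bs , refl ← ∈-∃++ m∈ = rotated (++-comm as (m ∷ bs))
    where
      open Cycle C
      open PermutationProperties (setoid (Fin n))
        using (++-comm; Unique-resp-↭; ∈-resp-↭) renaming (xs↭ys⇒|xs|≡|ys| to ↭-length)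
      open Permutation (setoid (Fin n)) using (_↭_; ↭-sym)
      rotated : as ++ m ∷ bs ↭ m ∷ bs ++ as →
                ∃₂ λ a b → a ≢ b × a ∈ as ++ m ∷ bs × b ∈ as ++ m ∷ bs × E a m ≡ true × E m b ≡ true
      rotated π
        with a , b , a≢b , a∈ , b∈ , am , mb ←
               closedChain-neighbours (bs ++ as) (subst (3 ≤_) (↭-length π) long)
                                      (Unique-resp-↭ π uniq) (closedChain-rotate as m bs closed)
        = a , b , a≢b , back a∈ , back b∈ , am , mb
        where
          back : ∀ {y} → y ∈ bs ++ as → y ∈ as ++ m ∷ bs
          back = ∈-resp-↭ (↭-sym π) ∘ there

module BreadthFirst {n : ℕ} (E : Fin n → Fin n → Bool) (r : Fin n) (path : ∀ v → Walk E v r) where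

  Within : ℕ → Fin n → Set
  Within zero    v = v ≡ r
  Within (suc i) v = Within i v ⊎ ∃ λ w → E v w ≡ true × Within i w

  within? : ∀ i v → Dec (Within i v)
  within? zero    v = v ≟ r
  within? (suc i) v = within? i v ⊎-dec any? (λ w → (E v w Bool.≟ true) ×-dec within? i w)

  within-walk : ∀ {v} (p : Walk E v r) → Within (walk-length p) v
  within-walk here       = refl
  within-walk (step e p) = inj₂ (_ , e , within-walk p)

  dist : Fin n → ℕ
  dist v = least (λ i → within? i v) (walk-length (path v))

  dist-within : ∀ v → Within (dist v) v
  dist-within v = least-holds (λ i → within? i v) _ (within-walk (path v))

  dist-≤ : ∀ {v i} → Within i v → dist v ≤ i
  dist-≤ {v} = least-≤ (λ i → within? i v) (walk-length (path v))

  descend : ∀ {v} → v ≢ r → ∃ λ w → E v w ≡ true × dist w < dist v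
  descend {v} v≢r with dist v in eq | dist-within v
  ... | zero  | v≡r                = ⊥-elim (v≢r v≡r)
  ... | suc i | inj₁ Wᵢv           = ⊥-elim (<-irrefl refl (subst (_≤ i) eq (dist-≤ Wᵢv)))
  ... | suc i | inj₂ (w , e , Wᵢw) = w , e , s≤s (dist-≤ Wᵢw)

  next : Fin n → Fin n
  next v with v ≟ r
  ... | yes _   = r
  ... | no  v≢r = proj₁ (descend v≢r)

  next-edge : ∀ {v} → v ≢ r → E v (next v) ≡ true
  next-edge {v} v≢r with v ≟ r
  ... | yes v≡r = ⊥-elim (v≢r v≡r)
  ... | no  v≢r = proj₁ (proj₂ (descend v≢r))

  dist-next : ∀ {v} → v ≢ r → dist (next v) < dist v
  dist-next {v} v≢r with v ≟ r
  ... | yes v≡r = ⊥-elim (v≢r v≡r)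
  ... | no  v≢r = proj₂ (proj₂ (descend v≢r))

module Arborescence {n : ℕ} (r : Fin n) (parent : Fin n → Fin n) (height : Fin n → ℕ)
                    (height-parent : ∀ {v} → v ≢ r → height (parent v) < height v) where

  ChildOf : Fin n → Fin n → Set
  ChildOf u v = u ≢ r × parent u ≡ v

  childOf? : ∀ u v → Dec (ChildOf u v)
  childOf? u v = ¬? (u ≟ r) ×-dec (parent u ≟ v)

  height-child : ∀ {u v} → ChildOf u v → height v < height u
  height-child (u≢r , refl) = height-parent u≢r

  childOf-asym : ∀ {u v} → ChildOf u v → ¬ ChildOf v u
  childOf-asym uv vu = <-asym (height-child uv) (height-child vu)

  Adjacent : Fin n → Fin n → Set
  Adjacent u v = ChildOf u v ⊎ ChildOf v u

  edge : Fin n → Fin n → Bool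
  edge u v = does (childOf? u v ⊎-dec childOf? v u)

  edge-sym : ∀ u v → edge u v ≡ edge v u
  edge-sym u v =
    does-⇔ (mk⇔ Sum.swap Sum.swap) (childOf? u v ⊎-dec childOf? v u) (childOf? v u ⊎-dec childOf? u v)

  adjacent : ∀ {u v} → edge u v ≡ true → Adjacent u v
  adjacent {u} {v} = witness (childOf? u v ⊎-dec childOf? v u)

  edge-to-parent : ∀ {v} → v ≢ r → edge v (parent v) ≡ true
  edge-to-parent {v} v≢r =
    dec-true (childOf? v (parent v) ⊎-dec childOf? (parent v) v) (inj₁ (v≢r , refl))

  walk-to-root : ∀ h v → height v < h → Walk edge v r
  walk-to-root (suc h) v v<h with v ≟ r
  ... | yes refl = here
  ... | no  v≢r  = step (edge-to-parent v≢r)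
                        (walk-to-root h (parent v) (<-≤-trans (height-parent v≢r) (s≤s⁻¹ v<h)))

  edge-connected : ∀ u v → Walk edge u v
  edge-connected u v = walk-to-root _ u ≤-refl ◅◅ walk-reverse edge-sym (walk-to-root _ v ≤-refl)

  parent-of-lower : ∀ {a m} → edge a m ≡ true → height a ≤ height m → parent m ≡ a
  parent-of-lower am a≤m with adjacent am
  ... | inj₁ a→m       = ⊥-elim (<-irrefl refl (<-≤-trans (height-child a→m) a≤m))
  ... | inj₂ (_ , m→a) = m→a

  -- The highest vertex of a cycle would have two distinct parents.
  highest-not-on-cycle : (C : Cycle edge) → ∀ {m} → m ∈ Cycle.verts C →
                         (∀ {y} → y ∈ Cycle.verts C → height y ≤ height m) → ⊥
  highest-not-on-cycle C {m} m∈ highest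
    with a , b , a≢b , a∈ , b∈ , am , mb ← cycle-neighbours edge C m∈
    = a≢b (trans (sym (parent-of-lower am (highest a∈)))
                 (parent-of-lower (trans (edge-sym b m) mb) (highest b∈)))

  edge-acyclic : Cycle edge → ⊥
  edge-acyclic C@record { verts = x ∷ xs } =
    highest-not-on-cycle C (argmax-∈ height x xs) (argmax-maximal height x xs)

  children : Fin n → ℕ
  children v = count (λ u → does (childOf? u v)) (allFin n)

  rank : Fin n → ℕ
  rank c = count (λ u → does (childOf? u (parent c) ×-dec u <? c)) (allFin n)

  rank-< : ∀ {c} → c ≢ r → rank c < children (parent c)
  rank-< {c} c≢r = count-mono-< sibling⇒child (∈-allFin c)
    (dec-false (childOf? c (parent c) ×-dec c <? c) (λ (_ , c<c) → <-irrefl refl c<c))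
    (dec-true (childOf? c (parent c)) (c≢r , refl))
    where
      sibling⇒child : ∀ {u} → does (childOf? u (parent c) ×-dec u <? c) ≡ true →
                              does (childOf? u (parent c)) ≡ true
      sibling⇒child {u} s =
        dec-true (childOf? u (parent c)) (proj₁ (witness (childOf? u (parent c) ×-dec u <? c) s))

  rank-mono-< : ∀ {c c' v} → ChildOf c v → ChildOf c' v → c <ᶠ c' → rank c < rank c'
  rank-mono-< {c} {c'} (c≢r , refl) (_ , pc'≡pc) c<c' = count-mono-< earlier-sibling (∈-allFin c)
    (dec-false (childOf? c (parent c) ×-dec c <? c) (λ (_ , c<c) → <-irrefl refl c<c))
    (dec-true (childOf? c (parent c') ×-dec c <? c') ((c≢r , sym pc'≡pc) , c<c'))
    where
      earlier-sibling : ∀ {u} → does (childOf? u (parent c) ×-dec u <? c) ≡ true →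
                                does (childOf? u (parent c') ×-dec u <? c') ≡ true
      earlier-sibling {u} s
        with (u≢r , pu≡pc) , u<c ← witness (childOf? u (parent c) ×-dec u <? c) s =
        dec-true (childOf? u (parent c') ×-dec u <? c')
                 ((u≢r , trans pu≡pc (sym pc'≡pc)) , <-trans u<c c<c')

  rank-injective : ∀ {c c' v} → ChildOf c v → ChildOf c' v → rank c ≡ rank c' → c ≡ c'
  rank-injective {c} {c'} cv c'v rc≡rc' with <-cmp c c'
  ... | tri< c<c' _ _ = ⊥-elim (<-irrefl rc≡rc' (rank-mono-< cv c'v c<c'))
  ... | tri≈ _ c≡c' _ = c≡c'
  ... | tri> _ _ c'<c = ⊥-elim (<-irrefl (sym rc≡rc') (rank-mono-< c'v cv c'<c))

  module Colouring (Δ : ℕ) (children-root : children r ≤ suc Δ)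
                   (children-nonroot : ∀ {v} → v ≢ r → children v ≤ Δ) where

    -- The colour of the edge from c to its parent; the fuel f stands in for
    -- well-founded recursion on height.
    colourAt : ℕ → Fin n → Fin (suc Δ)
    colourAt zero    c = zero
    colourAt (suc f) c with c ≟ r | parent c ≟ r
    ... | yes _   | _         = zero
    ... | no  c≢r | yes refl  = fromℕ< (<-≤-trans (rank-< c≢r) children-root)
    ... | no  c≢r | no  pc≢r  =
      punchIn (colourAt f (parent c)) (fromℕ< (<-≤-trans (rank-< c≢r) (children-nonroot pc≢r)))

    colour : Fin n → Fin (suc Δ)
    colour c = colourAt (suc (height c)) c

    colourAt-stable : ∀ f g c → height c < f → height c < g → colourAt f c ≡ colourAt g c
    colourAt-stable (suc f) (suc g) c c<f c<g with c ≟ r | parent c ≟ r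
    ... | yes _   | _        = refl
    ... | no  _   | yes refl = refl
    ... | no  c≢r | no  _    = cong (λ a → punchIn a _)
      (colourAt-stable f g (parent c) (<-≤-trans (height-parent c≢r) (s≤s⁻¹ c<f))
                                      (<-≤-trans (height-parent c≢r) (s≤s⁻¹ c<g)))

    colour-rootChild : ∀ {c} → ChildOf c r → toℕ (colour c) ≡ rank c
    colour-rootChild {c} (c≢r , pc≡r) with c ≟ r | parent c ≟ r
    ... | yes c≡r | _        = ⊥-elim (c≢r c≡r)
    ... | no  _   | yes refl = toℕ-fromℕ< _
    ... | no  _   | no pc≢r  = ⊥-elim (pc≢r pc≡r)

    colourAt-child : ∀ {c} f → c ≢ r → parent c ≢ r →
                     ∃ λ j → toℕ j ≡ rank c × colourAt (suc f) c ≡ punchIn (colourAt f (parent c)) j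
    colourAt-child {c} f c≢r pc≢r with c ≟ r | parent c ≟ r
    ... | yes c≡r | _        = ⊥-elim (c≢r c≡r)
    ... | no  _   | yes pc≡r = ⊥-elim (pc≢r pc≡r)
    ... | no  _   | no  _    = _ , toℕ-fromℕ< _ , refl

    colour-child : ∀ {c v} → ChildOf c v → v ≢ r →
                   ∃ λ j → toℕ j ≡ rank c × colour c ≡ punchIn (colour v) j
    colour-child {c} (c≢r , refl) pc≢r with j , j≡ , eq ← colourAt-child (height c) c≢r pc≢r =
      j , j≡ , trans eq (cong (λ a → punchIn a j) refuel)
      where
        refuel : colourAt (height c) (parent c) ≡ colour (parent c)
        refuel = colourAt-stable _ _ (parent c) (height-parent c≢r) ≤-refl

    colour-≢-parent : ∀ {c v} → ChildOf c v → v ≢ r → colour c ≢ colour v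
    colour-≢-parent cv v≢r with j , _ , eq ← colour-child cv v≢r = punchInᵢ≢i _ j ∘ trans (sym eq)

    colour-≢-sibling : ∀ {c c' v} → ChildOf c v → ChildOf c' v → c ≢ c' → colour c ≢ colour c'
    colour-≢-sibling {c} {c'} {v} cv c'v c≢c' same = c≢c' (rank-injective cv c'v (same-rank (v ≟ r)))
      where
        open ≡-Reasoning
        same-rank : Dec (v ≡ r) → rank c ≡ rank c'
        same-rank (yes refl) = begin
          rank c          ≡⟨ colour-rootChild cv ⟨
          toℕ (colour c)  ≡⟨ cong toℕ same ⟩
          toℕ (colour c') ≡⟨ colour-rootChild c'v ⟩
          rank c'         ∎
        same-rank (no v≢r)
          with j , j≡ , eq ← colour-child cv v≢r | j' , j'≡ , eq' ← colour-child c'v v≢r = begin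
          rank c  ≡⟨ j≡ ⟨
          toℕ j   ≡⟨ cong toℕ (punchIn-injective (colour v) j j' (trans (sym eq) (trans same eq'))) ⟩
          toℕ j'  ≡⟨ j'≡ ⟩
          rank c' ∎

    edgeColour : Fin n → Fin n → Fin (suc Δ)
    edgeColour u v with childOf? u v | childOf? v u
    ... | yes _ | _     = colour u
    ... | no  _ | yes _ = colour v
    ... | no  _ | no  _ = zero

    edgeColour-sym : ∀ u v → edgeColour u v ≡ edgeColour v u
    edgeColour-sym u v with childOf? u v | childOf? v u
    ... | yes uv | yes vu = ⊥-elim (childOf-asym uv vu)
    ... | yes _  | no  _  = refl
    ... | no  _  | yes _  = refl
    ... | no  _  | no  _  = refl

    edgeColour-child : ∀ {u v} → ChildOf u v → edgeColour u v ≡ colour u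
    edgeColour-child {u} {v} uv with childOf? u v
    ... | yes _  = refl
    ... | no ¬uv = ⊥-elim (¬uv uv)

    edgeColour-parent : ∀ {u v} → ChildOf v u → edgeColour u v ≡ colour v
    edgeColour-parent {u} {v} vu = trans (edgeColour-sym u v) (edgeColour-child vu)

    edgeColour-proper : ∀ {u v w} → edge u v ≡ true → edge v w ≡ true → u ≢ w →
                        edgeColour u v ≢ edgeColour v w
    edgeColour-proper uv vw u≢w with adjacent uv | adjacent vw
    ... | inj₁ u→v | inj₁ v→w = λ same → colour-≢-parent u→v (proj₁ v→w)
            (trans (sym (edgeColour-child u→v)) (trans same (edgeColour-child v→w)))
    ... | inj₁ u→v | inj₂ w→v = λ same → colour-≢-sibling u→v w→v u≢w
            (trans (sym (edgeColour-child u→v)) (trans same (edgeColour-parent w→v)))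
    ... | inj₂ (_ , v→u) | inj₁ (_ , v→w) = ⊥-elim (u≢w (trans (sym v→u) v→w))
    ... | inj₂ v→u | inj₂ w→v = λ same → colour-≢-parent w→v (proj₁ v→u)
            (trans (sym (edgeColour-parent w→v)) (trans (sym same) (edgeColour-parent v→u)))

module RootedSpanningTree {n : ℕ} {G : Graph n} (T : Tree G) (spanning : SpanningTree G T) (r : Fin n)
  where

  open BreadthFirst (E T) r (λ v → conn T v r (spanning v) (spanning r))
  open Arborescence r next dist dist-next

  child⇒E : ∀ {u v} → ChildOf u v → E T u v ≡ true
  child⇒E (u≢r , refl) = next-edge u≢r

  edge⇒E : ∀ {u v} → edge u v ≡ true → E T u v ≡ true
  edge⇒E uv with adjacent uv
  ... | inj₁ u→v = child⇒E u→v
  ... | inj₂ v→u = trans (E-sym T _ _) (child⇒E v→u)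

  bfsTree : Tree G
  bfsTree = record
    { V        = ⊤
    ; E        = edge
    ; E-sym    = edge-sym
    ; E⊆G      = λ u v uv → E⊆G T u v (edge⇒E uv)
    ; E⊆V      = λ _ _ _ → ∈⊤
    ; nonempty = r , ∈⊤
    ; conn     = λ u v _ _ → edge-connected u v
    ; acyclic  = edge-acyclic
    }

  private
    child⇒neighbour : ∀ {v u} → does (childOf? u v) ≡ true → E T v u ≡ true
    child⇒neighbour {v} {u} uv = trans (E-sym T v u) (child⇒E (witness (childOf? u v) uv))

  children≤degree : ∀ v → children v ≤ degree T v
  children≤degree v = count-mono child⇒neighbour (allFin n)

  -- the parent of v is a neighbour but not a child
  children<degree : ∀ {v} → v ≢ r → children v < degree T v
  children<degree {v} v≢r = count-mono-< child⇒neighbour (∈-allFin (next v))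
    (dec-false (childOf? (next v) v) (childOf-asym (v≢r , refl))) (next-edge v≢r)

  degree≤maxDegree : ∀ v → degree T v ≤ maxDegree T
  degree≤maxDegree v = ≤-foldr-⊔ (degree T) (allFin n) (∈-allFin v)

  maxDegree-positive : ∀ {v} → v ≢ r → 0 < maxDegree T
  maxDegree-positive {v} v≢r = ≤-trans (s≤s z≤n) (≤-trans (children<degree v≢r) (degree≤maxDegree v))

  module _ {Δ : ℕ} (maxDegree≡ : maxDegree T ≡ suc Δ) where

    open Colouring Δ
      (subst (children r ≤_) maxDegree≡ (≤-trans (children≤degree r) (degree≤maxDegree r)))
      (λ {v} v≢r → s≤s⁻¹ (subst (suc (children v) ≤_) maxDegree≡
                                 (<-≤-trans (children<degree v≢r) (degree≤maxDegree v))))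

    bfsColouring : EdgeColoring G (suc Δ)
    bfsColouring = record { col = edgeColour ; col-sym = edgeColour-sym }

    bfsTree-proper : ProperTree bfsColouring bfsTree
    bfsTree-proper _ _ _ = edgeColour-proper

  px≤maxDegree : ∀ {v} → v ≢ r → ∀ k → px≤ G k (maxDegree T)
  px≤maxDegree v≢r k with maxDegree T in maxDegree≡
  ... | zero  = ⊥-elim (<-irrefl (sym maxDegree≡) (maxDegree-positive v≢r))
  ... | suc Δ = bfsColouring maxDegree≡ , λ _ _ → bfsTree , (λ _ → ∈⊤) , bfsTree-proper maxDegree≡

proposition3p3 : ∀ (n : ℕ) (G : Graph n) → 3 ≤ n → Connected G →
                 ∀ (k : ℕ) → 3 ≤ k → k ≤ n →
                 ∀ (T : Tree G) → SpanningTree G T →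
                 px≤ G k (maxDegree T)
proposition3p3 (suc zero) _ (s≤s ()) _ _ _ _ _ _
proposition3p3 (suc (suc _)) G _ _ k _ _ T spanning =
  RootedSpanningTree.px≤maxDegree T spanning zero {v = suc zero} (λ ()) k
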